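{- Let $\mathcal{C},F$ and $\mathcal{D},G$ be pointed simplicial models (with $F\in\mathcal{F}(C^{\mathcal{C}})$, $G\in\mathcal{F}(C^{\mathcal{D}})$), and let $\mathcal{M},w$ and $\mathcal{N},v$ be pointed first-order Kripke models. If $\mathcal{C},F$ and $\mathcal{D},G$ are bisimilar, then they are $\mathcal{L}^{[:=]}$-logically equivalent, i.e. for every sentence $\alpha\in\mathcal{L}_0^{[:=]}$, $\mathcal{C},F\Vdash\alpha$ iff $\mathcal{D},G\Vdash\alpha$. Likewise, if $\mathcal{M},w$ and $\mathcal{N},v$ are bisimilar, then for every sentence $\alpha\in\mathcal{L}_0^{[:=]}$, $\mathcal{M},w\vDash\alpha$ iff $\mathcal{N},v\vDash\alpha$.
   Context: Fix a nonempty finite set $\mathbf{A}$ of agents, a countable set $\mathbf{X}$ of variables with $\mathbf{A}\cap\mathbf{X}=\emptyset$, and a countable set $\mathbf{P}$ of predicate letters. Formulas of $\mathcal{L}^{[:=]}$ and their free variables $FV$ are defined simultaneously: $\phi ::= p_x \mid \top \mid \neg\phi \mid (\phi\wedge\phi) \mid [x:=a]\phi \mid \mathsf{K}_X\alpha$, where $p\in\mathbf{P}$, $x\in\mathbf{X}$, $a\in\mathbf{A}$, $X\subseteq\mathbf{X}$ is finite (possibly empty) and $\alpha$ is a formula with $FV(\alpha)=\emptyset$; $FV(p_x)=\{x\}$, $FV(\top)=\emptyset$, $FV(\neg\phi)=FV(\phi)$, $FV(\phi\wedge\psi)=FV(\phi)\cup FV(\psi)$, $FV([x:=a]\phi)=FV(\phi)\setminus\{x\}$,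 $FV(\mathsf{K}_X\alpha)=X$. Other Boolean connectives are defined as usual, $\langle x:=a\rangle\phi:=\neg[x:=a]\neg\phi$, $\widehat{\mathsf K}_X\alpha:=\neg\mathsf K_X\neg\alpha$. Sentences are formulas without free variables; $\mathcal{L}_0^{[:=]}$ is the set of sentences. A simplicial model is $\mathcal{C}=(\mathcal{V},C,\chi,\ell)$ with $\mathcal{V}\neq\emptyset$, $C\subseteq\wp(\mathcal{V})$ such that $\emptyset\notin C$, $C$ is closed under nonempty subsets, and $\{v\}\in C$ for all $v\in\mathcal V$; $\chi:\mathcal{V}\to\mathbf{A}$ is injective on every face; $\ell:\mathbf{P}\to\wp(\mathcal{V})$. Facets $\mathcal{F}(C)$ are the faces not properly contained in another face. A first-order Kripke model is $\mathcal{M}=(W,\delta,\{R_a\}_{a\in\mathbf{A}},\rho)$ with $W\neq\emptyset$, $\delta:W\to\wp(\mathbf{A})\setminus\{\emptyset\}$, $R_a\subseteq W\times W$ with $R_a(w)=\emptyset$ whenever $a\notin\delta(w)$, and $\rho:\mathbf{P}\times W\to\wp(\mathbf{A})$ with $\rho(p,w)\subseteq\delta(w)$. An assignment is $\sigma:\mathbf{X}\to\mathbf{A}$; it is admissible for $\mathcal{C},F,\phi$ if $\sigma[FV(\phi)]\subseteq\chi[F]$, and for $\mathcal{M},w,\phi$ if $\sigma[FV(\phi)]\subseteq\delta(w)$. For admissible $\sigma$ (Boolean clauses as usual): $\mathcal{C},F,\sigma\Vdash p_x$ iff $\sigma(x)\in\chi[F\cap\ell(p)]$; $\mathcal{C},F,\sigma\Vdash[x:=a]\phi$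 iff ($a\in\chi[F]$ implies $\mathcal{C},F,\sigma[x\mapsto a]\Vdash\phi$); $\mathcal{C},F,\sigma\Vdash\mathsf{K}_X\alpha$ iff for all $G\in\mathcal{F}(C)$ with $\sigma[X]\subseteq\chi[F\cap G]$, $\mathcal{C},G,\sigma\Vdash\alpha$. $\mathcal{M},w,\sigma\vDash p_x$ iff $\sigma(x)\in\rho(p,w)$; $\mathcal{M},w,\sigma\vDash[x:=a]\phi$ iff ($a\in\delta(w)$ implies $\mathcal{M},w,\sigma[x\mapsto a]\vDash\phi$); $\mathcal{M},w,\sigma\vDash\mathsf{K}_X\alpha$ iff for all $v\in\bigcap_{a\in\sigma[X]}R_a(w)$ (where the empty intersection is $W$), $\mathcal{M},v,\sigma\vDash\alpha$. For sentences truth does not depend on $\sigma$, and one writes $\mathcal{C},F\Vdash\alpha$, $\mathcal{M},w\vDash\alpha$. A relation $Z\subseteq\mathcal{F}(C^{\mathcal C})\times\mathcal{F}(C^{\mathcal D})$ is a bisimulation between simplicial models $\mathcal{C},\mathcal{D}$ if for all $(F,G)\in Z$: (Inv) $\chi^{\mathcal C}[F]=\chi^{\mathcal D}[G]$ and $\chi^{\mathcal C}[F\cap\ell^{\mathcal C}(p)]=\chi^{\mathcal D}[G\cap\ell^{\mathcal D}(p)]$ for all $p$; (Zig) for all $A\subseteq\mathbf{A}$ and $F'\in\mathcal{F}(C^{\mathcal C})$ with $A\subseteq\chi^{\mathcal C}[F\cap F']$ there is $G'\in\mathcal{F}(C^{\mathcal D})$ with $A\subseteq\chi^{\mathcal D}[G\cap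 G']$ and $(F',G')\in Z$; (Zag) symmetrically. A relation $Z\subseteq W^{\mathcal M}\times W^{\mathcal N}$ is a bisimulation between first-order Kripke models if for all $(w,v)\in Z$: (Inv) $\delta^{\mathcal M}(w)=\delta^{\mathcal N}(v)$ and $\rho^{\mathcal M}(p,w)=\rho^{\mathcal N}(p,v)$ for all $p$; (Zig) for all $A\subseteq\mathbf A$ and $w'\in\bigcap_{a\in A}R^{\mathcal M}_a(w)$ there is $v'\in\bigcap_{a\in A}R^{\mathcal N}_a(v)$ with $(w',v')\in Z$; (Zag) symmetrically. Pointed models are bisimilar if some bisimulation contains the pair of points. -}

module Defs where

open import Level using (Level; 0ℓ; Lift) renaming (suc to lsuc)
open import Data.Nat as ℕ using (ℕ; suc)
open import Data.Fin using (Fin)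
open import Data.List using (List)
open import Data.List.Membership.Propositional using (_∈_)
open import Data.Product using (Σ; _×_; _,_; ∃)
open import Data.Sum using (_⊎_)
open import Data.Empty using (⊥)
open import Data.Unit.Polymorphic using (⊤)
open import Relation.Nullary using (¬_; Dec; yes; no)
open import Relation.Unary using (Pred; _⊆_; _∩_)
open import Relation.Binary.PropositionalEquality using (_≡_; _≢_; cong)
open import Function using (_∘_)
open import Function.Bundles using (_↣_; Injection; _⇔_)

-- Parameters:
--   k     : agents are  Agent = Fin (suc k)  (a nonempty finite set)
--   Var   : the countable set of variables (countability: injection into ℕ)
--   Prd   : the set of predicate letters

module Logic (k : ℕ) (Var : Set) (encV : Var ↣ ℕ) (Prd : Set) where

  Agent : Set
  Agent = Fin (suc k)

  _≟V_ : (x y : Var) → Dec (x ≡ y)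
  x ≟V y with Injection.to encV x ℕ.≟ Injection.to encV y
  ... | yes e = yes (Injection.injective encV e)
  ... | no ne = no (ne ∘ cong (Injection.to encV))

  Assignment : Set
  Assignment = Var → Agent

  _[_↦_] : Assignment → Var → Agent → Assignment
  (σ [ x ↦ a ]) y with y ≟V x
  ... | yes _ = a
  ... | no _ = σ y

  -- raw syntax; the side condition FV(α) = ∅ in K_X α is imposed by WF below
  data Form : Set where
    atom   : Prd → Var → Form
    tt     : Form
    neg    : Form → Form
    conj   : Form → Form → Form
    assign : Var → Agent → Form → Form
    K      : List Var → Form → Form

  _∈FV_ : Var → Form → Set
  x ∈FV atom p y     = x ≡ y
  x ∈FV tt           = ⊥
  x ∈FV neg φ        = x ∈FV φ
  x ∈FV conj φ ψ     = x ∈FV φ ⊎ x ∈FV ψ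
  x ∈FV assign y a φ = x ∈FV φ × x ≢ y
  x ∈FV K X α        = x ∈ X

  Closed : Form → Set
  Closed φ = ∀ x → ¬ (x ∈FV φ)

  WF : Form → Set
  WF (atom p x)     = ⊤
  WF tt             = ⊤
  WF (neg φ)        = WF φ
  WF (conj φ ψ)     = WF φ × WF ψ
  WF (assign x a φ) = WF φ
  WF (K X α)        = Closed α × WF α

  Sentence : Form → Set
  Sentence φ = WF φ × Closed φ

  imageV : Assignment → List Var → Pred Agent 0ℓ
  imageV σ X a = Σ Var λ x → x ∈ X × σ x ≡ a

  record SimplicialModel : Set₁ where
    field
      V        : Set
      V-ne     : V
      C        : Pred V 0ℓ → Set
      C-ne     : ∀ F → C F → Σ V F
      C-down   : ∀ F G → C F → G ⊆ F → Σ V G → C G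
      C-single : ∀ v → C (λ u → u ≡ v)
      χ        : V → Agent
      χ-inj    : ∀ F → C F → ∀ u v → F u → F v → χ u ≡ χ v → u ≡ v
      lab      : Prd → Pred V 0ℓ

    χ[_] : Pred V 0ℓ → Pred Agent 0ℓ
    χ[ F ] a = Σ V λ v → F v × χ v ≡ a

    IsFacet : Pred V 0ℓ → Set₁
    IsFacet F = C F × (∀ G → C G → F ⊆ G → G ⊆ F)

  open SimplicialModel public

  _,_,_⊩_ : (𝒞 : SimplicialModel) → Pred (V 𝒞) 0ℓ → Assignment → Form → Set₁
  𝒞 , F , σ ⊩ atom p x     = Lift _ (χ[_] 𝒞 (F ∩ lab 𝒞 p) (σ x))
  𝒞 , F , σ ⊩ tt           = ⊤
  𝒞 , F , σ ⊩ neg φ        = ¬ (𝒞 , F , σ ⊩ φ)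
  𝒞 , F , σ ⊩ conj φ ψ     = (𝒞 , F , σ ⊩ φ) × (𝒞 , F , σ ⊩ ψ)
  𝒞 , F , σ ⊩ assign x a φ = χ[_] 𝒞 F a → 𝒞 , F , (σ [ x ↦ a ]) ⊩ φ
  𝒞 , F , σ ⊩ K X α        =
    (G : Pred (V 𝒞) 0ℓ) → IsFacet 𝒞 G → imageV σ X ⊆ χ[_] 𝒞 (F ∩ G) → 𝒞 , G , σ ⊩ α

  record IsSBisimulation (𝒞 𝒟 : SimplicialModel)
         (Z : Pred (V 𝒞) 0ℓ → Pred (V 𝒟) 0ℓ → Set₁) : Set₂ where
    field
      facets : ∀ {F G} → Z F G → IsFacet 𝒞 F × IsFacet 𝒟 G
      inv-χ  : ∀ {F G} → Z F G → ∀ a → χ[_] 𝒞 F a ⇔ χ[_] 𝒟 G a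
      inv-ℓ  : ∀ {F G} → Z F G → ∀ p a →
               χ[_] 𝒞 (F ∩ lab 𝒞 p) a ⇔ χ[_] 𝒟 (G ∩ lab 𝒟 p) a
      zig    : ∀ {F G} → Z F G → (A : Pred Agent 0ℓ) (F' : Pred (V 𝒞) 0ℓ) →
               IsFacet 𝒞 F' → A ⊆ χ[_] 𝒞 (F ∩ F') →
               Σ (Pred (V 𝒟) 0ℓ) λ G' → IsFacet 𝒟 G' × A ⊆ χ[_] 𝒟 (G ∩ G') × Z F' G'
      zag    : ∀ {F G} → Z F G → (A : Pred Agent 0ℓ) (G' : Pred (V 𝒟) 0ℓ) →
               IsFacet 𝒟 G' → A ⊆ χ[_] 𝒟 (G ∩ G') →
               Σ (Pred (V 𝒞) 0ℓ) λ F' → IsFacet 𝒞 F' × A ⊆ χ[_] 𝒞 (F ∩ F') × Z F' G'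

  SBisimilar : (𝒞 𝒟 : SimplicialModel) → Pred (V 𝒞) 0ℓ → Pred (V 𝒟) 0ℓ → Set₂
  SBisimilar 𝒞 𝒟 F G =
    Σ (Pred (V 𝒞) 0ℓ → Pred (V 𝒟) 0ℓ → Set₁) λ Z → IsSBisimulation 𝒞 𝒟 Z × Z F G

  record KripkeModel : Set₁ where
    field
      W     : Set
      W-ne  : W
      δ     : W → Pred Agent 0ℓ
      δ-ne  : ∀ w → Σ Agent (δ w)
      R     : Agent → W → W → Set
      R-δ   : ∀ a w u → R a w u → δ w a
      ρ     : Prd → W → Pred Agent 0ℓ
      ρ-δ   : ∀ p w → ρ p w ⊆ δ w

  open KripkeModel public

  _,_,_⊨_ : (ℳ : KripkeModel) → W ℳ → Assignment → Form → Set
  ℳ , w , σ ⊨ atom p x     = ρ ℳ p w (σ x)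
  ℳ , w , σ ⊨ tt           = ⊤
  ℳ , w , σ ⊨ neg φ        = ¬ (ℳ , w , σ ⊨ φ)
  ℳ , w , σ ⊨ conj φ ψ     = (ℳ , w , σ ⊨ φ) × (ℳ , w , σ ⊨ ψ)
  ℳ , w , σ ⊨ assign x a φ = δ ℳ w a → ℳ , w , (σ [ x ↦ a ]) ⊨ φ
  ℳ , w , σ ⊨ K X α        =
    (u : W ℳ) → (∀ a → imageV σ X a → R ℳ a w u) → ℳ , u , σ ⊨ α

  record IsKBisimulation (ℳ 𝒩 : KripkeModel) (Z : W ℳ → W 𝒩 → Set) : Set₁ where
    field
      inv-δ : ∀ {w v} → Z w v → ∀ a → δ ℳ w a ⇔ δ 𝒩 v a
      inv-ρ : ∀ {w v} → Z w v → ∀ p a → ρ ℳ p w a ⇔ ρ 𝒩 p v a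
      zig   : ∀ {w v} → Z w v → (A : Pred Agent 0ℓ) (w' : W ℳ) →
              (∀ a → A a → R ℳ a w w') →
              Σ (W 𝒩) λ v' → (∀ a → A a → R 𝒩 a v v') × Z w' v'
      zag   : ∀ {w v} → Z w v → (A : Pred Agent 0ℓ) (v' : W 𝒩) →
              (∀ a → A a → R 𝒩 a v v') →
              Σ (W ℳ) λ w' → (∀ a → A a → R ℳ a w w') × Z w' v'

  KBisimilar : (ℳ 𝒩 : KripkeModel) → W ℳ → W 𝒩 → Set₁
  KBisimilar ℳ 𝒩 w v = Σ (W ℳ → W 𝒩 → Set) λ Z → IsKBisimulation ℳ 𝒩 Z × Z w v

  Pred′ : SimplicialModel → Set₁
  Pred′ 𝒞 = Pred (V 𝒞) 0ℓ

-- Both semantics interpret every connective by a truth condition that a bisimulation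
-- preserves: atoms and the domain of [x := a] by (Inv), and K_X by (Zig) and (Zag) applied
-- to the set of agents σ[X]. Hence truth of every formula, under every assignment, is
-- invariant along a bisimulation, by induction on the formula; sentences are a special case.
module Submission where

open import Defs
open import Data.Nat using (ℕ)
open import Data.Product using (_×_; _,_)
open import Data.Product.Function.NonDependent.Propositional using (_×-⇔_)
open import Function using (_∘_)
open import Function.Bundles using (_↣_; _⇔_; mk⇔; Equivalence)
open import Function.Construct.Identity using (⇔-id)
open import Function.Related.TypeIsomorphisms using (→-cong-⇔; ¬-cong-⇔)
open import Level using (Lift; lift; lower)

Lift-cong-⇔ : ∀ {a b ℓ} {A : Set a} {B : Set b} → A ⇔ B → Lift ℓ A ⇔ Lift ℓ B
Lift-cong-⇔ A⇔B = mk⇔ (lift ∘ to ∘ lower) (lift ∘ from ∘ lower)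
  where open Equivalence A⇔B

module Invariance (k : ℕ) (Var : Set) (encV : Var ↣ ℕ) (Prd : Set) where
  open Logic k Var encV Prd
  open Equivalence

  module _ {𝒞 𝒟 : SimplicialModel} {Z : Pred′ 𝒞 → Pred′ 𝒟 → Set₁}
           (bisim : IsSBisimulation 𝒞 𝒟 Z) where
    open IsSBisimulation bisim

    ⊩-bisimulation-invariant : ∀ {F G} → Z F G → ∀ φ σ →
                               (𝒞 , F , σ ⊩ φ) ⇔ (𝒟 , G , σ ⊩ φ)
    ⊩-bisimulation-invariant z (atom p x)     σ = Lift-cong-⇔ (inv-ℓ z p (σ x))
    ⊩-bisimulation-invariant z tt             σ = ⇔-id _
    ⊩-bisimulation-invariant z (neg φ)        σ = ¬-cong-⇔ (⊩-bisimulation-invariant z φ σ)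
    ⊩-bisimulation-invariant z (conj φ ψ)     σ =
      ⊩-bisimulation-invariant z φ σ ×-⇔ ⊩-bisimulation-invariant z ψ σ
    ⊩-bisimulation-invariant z (assign x a φ) σ =
      →-cong-⇔ (inv-χ z a) (⊩-bisimulation-invariant z φ (σ [ x ↦ a ]))
    ⊩-bisimulation-invariant z (K X α)        σ = mk⇔ forth back
      where
      forth : 𝒞 , _ , σ ⊩ K X α → 𝒟 , _ , σ ⊩ K X α
      forth h G′ G′-facet σX⊆ =
        let F′ , F′-facet , σX⊆′ , z′ = zag z (imageV σ X) G′ G′-facet σX⊆
        in to (⊩-bisimulation-invariant z′ α σ) (h F′ F′-facet σX⊆′)
      back : 𝒟 , _ , σ ⊩ K X α → 𝒞 , _ , σ ⊩ K X α
      back h F′ F′-facet σX⊆ =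
        let G′ , G′-facet , σX⊆′ , z′ = zig z (imageV σ X) F′ F′-facet σX⊆
        in from (⊩-bisimulation-invariant z′ α σ) (h G′ G′-facet σX⊆′)

  module _ {ℳ 𝒩 : KripkeModel} {Z : W ℳ → W 𝒩 → Set}
           (bisim : IsKBisimulation ℳ 𝒩 Z) where
    open IsKBisimulation bisim

    ⊨-bisimulation-invariant : ∀ {w v} → Z w v → ∀ φ σ →
                               (ℳ , w , σ ⊨ φ) ⇔ (𝒩 , v , σ ⊨ φ)
    ⊨-bisimulation-invariant z (atom p x)     σ = inv-ρ z p (σ x)
    ⊨-bisimulation-invariant z tt             σ = ⇔-id _
    ⊨-bisimulation-invariant z (neg φ)        σ = ¬-cong-⇔ (⊨-bisimulation-invariant z φ σ)
    ⊨-bisimulation-invariant z (conj φ ψ)     σ =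
      ⊨-bisimulation-invariant z φ σ ×-⇔ ⊨-bisimulation-invariant z ψ σ
    ⊨-bisimulation-invariant z (assign x a φ) σ =
      →-cong-⇔ (inv-δ z a) (⊨-bisimulation-invariant z φ (σ [ x ↦ a ]))
    ⊨-bisimulation-invariant z (K X α)        σ = mk⇔ forth back
      where
      forth : ℳ , _ , σ ⊨ K X α → 𝒩 , _ , σ ⊨ K X α
      forth h v′ σX-successor =
        let w′ , σX-successor′ , z′ = zag z (imageV σ X) v′ σX-successor
        in to (⊨-bisimulation-invariant z′ α σ) (h w′ σX-successor′)
      back : 𝒩 , _ , σ ⊨ K X α → ℳ , _ , σ ⊨ K X α
      back h w′ σX-successor =
        let v′ , σX-successor′ , z′ = zig z (imageV σ X) w′ σX-successor
        in from (⊨-bisimulation-invariant z′ α σ) (h v′ σX-successor′)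

mainTheorem1 : (k : ℕ) (Var Prd : Set) (encV : Var ↣ ℕ) (encP : Prd ↣ ℕ) →
    let open Logic k Var encV Prd in
    ((𝒞 𝒟 : SimplicialModel) (F : Pred′ 𝒞) (G : Pred′ 𝒟) →
       IsFacet 𝒞 F → IsFacet 𝒟 G → SBisimilar 𝒞 𝒟 F G →
       (α : Form) → Sentence α → (σ : Assignment) →
       (𝒞 , F , σ ⊩ α) ⇔ (𝒟 , G , σ ⊩ α))
    ×
    ((ℳ 𝒩 : KripkeModel) (w : W ℳ) (v : W 𝒩) → KBisimilar ℳ 𝒩 w v →
       (α : Form) → Sentence α → (σ : Assignment) →
       (ℳ , w , σ ⊨ α) ⇔ (𝒩 , v , σ ⊨ α))
mainTheorem1 k Var Prd encV _ =
  (λ { _ _ _ _ _ _ (_ , bisim , z) α _ → ⊩-bisimulation-invariant bisim z α })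
  ,
  (λ { _ _ _ _ (_ , bisim , z) α _ → ⊨-bisimulation-invariant bisim z α })
  where open Invariance k Var encV Prd
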